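{- Let $S=\{s_1,\dots,s_t\}$ with $1<s_1<\dots<s_t$ integers and $\gcd(s_1,\dots,s_t)=1$, and let $\mathbb{S}=\langle S\rangle$. Then there exists an infinite set $\mathbb{M}\subseteq\mathbb{S}$ of integers that are representable but not greedy-representable.
   Context: $\langle S\rangle=\{\sum_i a_i s_i : a_i\in\mathbb{N}_0\}$; an integer $k$ is representable if $k\in\langle S\rangle$. The (standard) greedy payment method on input $k>0$: for $i=t,t-1,\dots,1$ set $a_i:=\lfloor k/s_i\rfloor$ and replace $k$ by $k \bmod s_i$, stopping as soon as $k=0$. An integer $k>0$ is greedy-representable if this method produces a vector $(a_1,\dots,a_t)\in\mathbb{N}_0^t$ with $\sum_i a_is_i=k$ (i.e. the remainder reaches $0$). -}

module Defs where

open import Data.Nat using (ℕ; zero; suc; _+_; _*_; _<_; _≤_)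
open import Data.Nat.DivMod using (_/_; _%_)
open import Data.Nat.GCD using (gcd)
open import Data.Fin using (Fin)
open import Data.Vec using (Vec; []; _∷_; lookup; foldr)
open import Data.Product using (_×_; _,_; ∃; proj₁; proj₂)
open import Relation.Binary.PropositionalEquality using (_≡_)

dot : ∀ {t} → Vec ℕ t → Vec ℕ t → ℕ
dot [] [] = 0
dot (a ∷ as) (s ∷ ss) = a * s + dot as ss

-- gcd(s_1,…,s_t)  (gcd of the empty family is 0)
gcdAll : ∀ {t} → Vec ℕ t → ℕ
gcdAll = foldr _ gcd 0

Representable : ∀ {t} → Vec ℕ t → ℕ → Set
Representable {t} s k = ∃ λ (a : Vec ℕ t) → dot a s ≡ k

-- floor division / remainder (division by 0 conventionally trivial; never used
-- under the hypotheses since all s_i > 1)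
quot : ℕ → ℕ → ℕ
quot k zero = 0
quot k (suc n) = k / suc n

rem : ℕ → ℕ → ℕ
rem k zero = k
rem k (suc n) = k % suc n

-- Greedy payment method on generators s = (s_1,…,s_t) in increasing order:
-- processes i = t, t-1, …, 1, setting a_i := ⌊k/s_i⌋ and k := k mod s_i.
greedy : ∀ {t} → Vec ℕ t → ℕ → Vec ℕ t × ℕ
greedy [] k = [] , k
greedy (s ∷ ss) k =
  let r = greedy ss k
  in (quot (proj₂ r) s ∷ proj₁ r) , rem (proj₂ r) s

GreedyRepresentable : ∀ {t} → Vec ℕ t → ℕ → Set
GreedyRepresentable s k = (0 < k) × (dot (proj₁ (greedy s k)) s ≡ k)

-- Let P be the product of the generators. By Bézout's identity the residues
-- modulo P of representable numbers are closed under gcd, so they contain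
-- gcd(S) = 1; adding multiples of the representable number P gives arbitrarily
-- large representable K ≡ 1 (mod P). Every s_i divides P, so K ≡ 1 (mod s_i)
-- for all i, and the greedy method, which only ever reduces its remainder
-- modulo some s_i, ends with remainder 1 instead of 0.
{-# OPTIONS --safe #-}
module Submission where

open import Defs
open import Data.Nat using (ℕ; zero; suc; _+_; _*_; _<_; _≤_; z<s; pred; NonZero; >-nonZero)
open import Data.Nat.Properties
open import Data.Nat.DivMod using (m≡m%n+[m/n]*n; [m+kn]%n≡m%n; m<n⇒m%n≡m)
open import Data.Nat.Divisibility using (_∣_; divides-refl; m∣m*n; ∣n⇒∣m*n)
open import Data.Nat.GCD using (gcd; gcd-GCD; gcd-comm; module Bézout)
open import Data.Nat.Solver using (module +-*-Solver)
open import Data.Fin using (Fin) renaming (_<_ to _<ᶠ_)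
import Data.Fin as Fin
open import Data.Vec using (Vec; lookup; []; _∷_; replicate; zipWith; map)
open import Data.Product using (_×_; ∃; _,_; proj₁; proj₂)
open import Data.Sum using (_⊎_; inj₁; inj₂)
open import Function using (_∘_)
open import Relation.Binary.PropositionalEquality
open import Relation.Nullary using (¬_)
open +-*-Solver

dot-zeroˡ : ∀ {t} (s : Vec ℕ t) → dot (replicate t 0) s ≡ 0
dot-zeroˡ [] = refl
dot-zeroˡ (x ∷ s) = dot-zeroˡ s

dot-distribʳ-+ : ∀ {t} (a b s : Vec ℕ t) → dot (zipWith _+_ a b) s ≡ dot a s + dot b s
dot-distribʳ-+ [] [] [] = refl
dot-distribʳ-+ (a ∷ as) (b ∷ bs) (x ∷ s) rewrite dot-distribʳ-+ as bs s =
  solve 5 (λ a b x p q → (a :+ b) :* x :+ (p :+ q) := (a :* x :+ p) :+ (b :* x :+ q))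
    refl a b x (dot as s) (dot bs s)

dot-map-* : ∀ {t} c (a s : Vec ℕ t) → dot (map (c *_) a) s ≡ c * dot a s
dot-map-* c [] [] = sym (*-zeroʳ c)
dot-map-* c (a ∷ as) (x ∷ s) rewrite dot-map-* c as s =
  solve 4 (λ c a x p → c :* a :* x :+ c :* p := c :* (a :* x :+ p)) refl c a x (dot as s)

module _ {t} (s : Vec ℕ t) where

  representable-0 : Representable s 0
  representable-0 = replicate t 0 , dot-zeroˡ s

  representable-+ : ∀ {a b} → Representable s a → Representable s b → Representable s (a + b)
  representable-+ (u , refl) (v , refl) = zipWith _+_ u v , dot-distribʳ-+ u v s

  representable-* : ∀ c {a} → Representable s a → Representable s (c * a)
  representable-* c (u , refl) = map (c *_) u , dot-map-* c u s

representable-∷ : ∀ {t} x {s : Vec ℕ t} {k} → Representable s k → Representable (x ∷ s) k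
representable-∷ x (u , eq) = 0 ∷ u , eq

representable-head : ∀ {t} x (s : Vec ℕ t) → Representable (x ∷ s) x
representable-head x s = 1 ∷ replicate _ 0 , (begin
  x + 0 + dot (replicate _ 0) s ≡⟨ cong (x + 0 +_) (dot-zeroˡ s) ⟩
  x + 0 + 0                     ≡⟨ cong (_+ 0) (+-identityʳ x) ⟩
  x + 0                         ≡⟨ +-identityʳ x ⟩
  x                             ∎)
  where open ≡-Reasoning

product : ∀ {t} → Vec ℕ t → ℕ
product [] = 1
product (x ∷ s) = x * product s

representable-product : ∀ {t} x (s : Vec ℕ t) → Representable (x ∷ s) (product (x ∷ s))
representable-product x s =
  subst (Representable (x ∷ s)) (*-comm (product s) x)
    (representable-* (x ∷ s) (product s) (representable-head x s))

lookup-∣-product : ∀ {t} (s : Vec ℕ t) (i : Fin t) → lookup s i ∣ product s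
lookup-∣-product (x ∷ s) Fin.zero = m∣m*n (product s)
lookup-∣-product (x ∷ s) (Fin.suc i) = ∣n⇒∣m*n x (lookup-∣-product s i)

product-nonZero : ∀ {t} (s : Vec ℕ t) → (∀ i → 0 < lookup s i) → NonZero (product s)
product-nonZero [] _ = _
product-nonZero (x ∷ s) pos =
  m*n≢0 x (product s) {{>-nonZero (pos Fin.zero)}} {{product-nonZero s (pos ∘ Fin.suc)}}

RepresentableMod : ∀ {t} → Vec ℕ t → ℕ → ℕ → Set
RepresentableMod s P d = ∃ λ j → Representable s (d + j * P)

module _ {t} (s : Vec ℕ t) (P : ℕ) where

  representable⇒representableMod : ∀ {d} → Representable s d → RepresentableMod s P d
  representable⇒representableMod {d} r = 0 , subst (Representable s) (sym (+-identityʳ d)) r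

  representableMod-+ : ∀ {a b} → RepresentableMod s P a → RepresentableMod s P b →
                       RepresentableMod s P (a + b)
  representableMod-+ {a} {b} (j , r) (j′ , r′) = j + j′ ,
    subst (Representable s)
      (solve 5 (λ a b j j′ P → (a :+ j :* P) :+ (b :+ j′ :* P) := (a :+ b) :+ (j :+ j′) :* P)
        refl a b j j′ P)
      (representable-+ s r r′)

  representableMod-* : ∀ c {a} → RepresentableMod s P a → RepresentableMod s P (c * a)
  representableMod-* c {a} (j , r) = c * j ,
    subst (Representable s)
      (solve 4 (λ c a j P → c :* (a :+ j :* P) := c :* a :+ c :* j :* P) refl c a j P)
      (representable-* s c r)

  representableMod-cancel : ∀ {d} c → RepresentableMod s P (d + c * P) → RepresentableMod s P d
  representableMod-cancel {d} c (j , r) = c + j ,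
    subst (Representable s)
      (solve 4 (λ d c j P → (d :+ c :* P) :+ j :* P := d :+ (c :+ j) :* P) refl d c j P) r

  -- d + y b = x a gives d ≡ x a + (P - 1) y b (mod P): subtraction of y b is
  -- replaced by adding P - 1 copies of it.
  representableMod-bézout : .{{_ : NonZero P}} → ∀ {a b d} x y → d + y * b ≡ x * a →
    RepresentableMod s P a → RepresentableMod s P b → RepresentableMod s P d
  representableMod-bézout {a} {b} {d} x y eq ra rb =
    representableMod-cancel (y * b)
      (subst (RepresentableMod s P) congruence
        (representableMod-+ (representableMod-* x ra)
                            (representableMod-* (pred P) (representableMod-* y rb))))
    where
    open ≡-Reasoning
    congruence : x * a + pred P * (y * b) ≡ d + y * b * P
    congruence = begin
      x * a + pred P * (y * b)       ≡⟨ cong (_+ pred P * (y * b)) (sym eq) ⟩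
      d + y * b + pred P * (y * b)   ≡⟨ +-assoc d (y * b) _ ⟩
      d + suc (pred P) * (y * b)     ≡⟨ cong (λ n → d + n * (y * b)) (suc-pred P) ⟩
      d + P * (y * b)                ≡⟨ cong (d +_) (*-comm P (y * b)) ⟩
      d + y * b * P                  ∎

  representableMod-gcd : .{{_ : NonZero P}} → ∀ {a b} →
    RepresentableMod s P a → RepresentableMod s P b → RepresentableMod s P (gcd a b)
  representableMod-gcd {a} {b} ra rb with Bézout.identity (gcd-GCD a b)
  ... | Bézout.+- x y eq = representableMod-bézout x y eq ra rb
  ... | Bézout.-+ x y eq =
    subst (RepresentableMod s P) (gcd-comm b a)
      (representableMod-bézout y x (subst (λ g → g + x * a ≡ y * b) (gcd-comm a b) eq) rb ra)

representableMod-∷ : ∀ {t} x {s : Vec ℕ t} {P d} → RepresentableMod s P d → RepresentableMod (x ∷ s) P d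
representableMod-∷ x (j , r) = j , representable-∷ x r

representableMod-gcdAll : ∀ {t} (s : Vec ℕ t) P .{{_ : NonZero P}} → RepresentableMod s P (gcdAll s)
representableMod-gcdAll [] P = representable⇒representableMod [] P (representable-0 [])
representableMod-gcdAll (x ∷ s) P =
  representableMod-gcd (x ∷ s) P
    (representable⇒representableMod (x ∷ s) P (representable-head x s))
    (representableMod-∷ x (representableMod-gcdAll s P))

rem+quot*≡ : ∀ k x → rem k x + quot k x * x ≡ k
rem+quot*≡ k zero = +-identityʳ k
rem+quot*≡ k (suc x) = sym (m≡m%n+[m/n]*n k (suc x))

rem-+-multiple : ∀ {c x n} → c < x → x ∣ n → rem (c + n) x ≡ c
rem-+-multiple {c} {suc x} c<x (divides-refl q) =
  trans ([m+kn]%n≡m%n c q (suc x)) (m<n⇒m%n≡m c<x)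

rem-small : ∀ {c x} → c < x → rem c x ≡ c
rem-small {x = suc x} = m<n⇒m%n≡m

greedy-dot-+-remainder : ∀ {t} (s : Vec ℕ t) k → dot (proj₁ (greedy s k)) s + proj₂ (greedy s k) ≡ k
greedy-dot-+-remainder [] k = refl
greedy-dot-+-remainder (x ∷ s) k = begin
  quot r x * x + dot a s + rem r x   ≡⟨ solve 3 (λ p d q → p :+ d :+ q := d :+ (q :+ p))
                                          refl (quot r x * x) (dot a s) (rem r x) ⟩
  dot a s + (rem r x + quot r x * x) ≡⟨ cong (dot a s +_) (rem+quot*≡ r x) ⟩
  dot a s + r                        ≡⟨ greedy-dot-+-remainder s k ⟩
  k                                  ∎
  where
  open ≡-Reasoning
  a : Vec ℕ _
  a = proj₁ (greedy s k)
  r : ℕ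
  r = proj₂ (greedy s k)

greedyRepresentable⇒remainder≡0 : ∀ {t} (s : Vec ℕ t) {k} → GreedyRepresentable s k → proj₂ (greedy s k) ≡ 0
greedyRepresentable⇒remainder≡0 s {k} (_ , exact) =
  +-cancelˡ-≡ k _ 0
    (trans (cong (_+ proj₂ (greedy s k)) (sym exact))
      (trans (greedy-dot-+-remainder s k) (sym (+-identityʳ k))))

greedy-remainder-constant : ∀ {t} (s : Vec ℕ t) {k c} →
  (∀ i → c < lookup s i) → (∀ i → rem k (lookup s i) ≡ c) →
  proj₂ (greedy s k) ≡ k ⊎ proj₂ (greedy s k) ≡ c
greedy-remainder-constant [] _ _ = inj₁ refl
greedy-remainder-constant (x ∷ s) c<s k≡c
  with greedy-remainder-constant s (c<s ∘ Fin.suc) (k≡c ∘ Fin.suc)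
... | inj₁ r≡k rewrite r≡k = inj₂ (k≡c Fin.zero)
... | inj₂ r≡c rewrite r≡c = inj₂ (rem-small (c<s Fin.zero))

¬greedyRepresentable : ∀ {t} (s : Vec ℕ t) {k c} → 0 < c →
  (∀ i → c < lookup s i) → (∀ i → rem k (lookup s i) ≡ c) → ¬ GreedyRepresentable s k
¬greedyRepresentable s 0<c c<s k≡c g@(0<k , _)
  with greedy-remainder-constant s c<s k≡c | greedyRepresentable⇒remainder≡0 s g
... | inj₁ r≡k | r≡0 = m<n⇒n≢0 0<k (trans (sym r≡k) r≡0)
... | inj₂ r≡c | r≡0 = m<n⇒n≢0 0<c (trans (sym r≡c) r≡0)

proposition2 : (t : ℕ) (s : Vec ℕ t)
    → (∀ (i : Fin t) → 1 < lookup s i)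
    → (∀ (i j : Fin t) → i <ᶠ j → lookup s i < lookup s j)
    → gcdAll s ≡ 1
    → ∀ (N : ℕ) → ∃ λ (k : ℕ) → (N ≤ k) × Representable s k × ¬ GreedyRepresentable s k
proposition2 zero [] _ _ () N
proposition2 (suc t) s@(x ∷ s′) 1<s _ gcd≡1 N =
  1 + (j + N) * P , N≤K , representable-K ,
  ¬greedyRepresentable s z<s 1<s (λ i → rem-+-multiple (1<s i) (∣n⇒∣m*n (j + N) (lookup-∣-product s i)))
  where
  P : ℕ
  P = product s
  instance
    P≢0 : NonZero P
    P≢0 = product-nonZero s (m<n⇒0<n ∘ 1<s)
  one-mod-P : RepresentableMod s P 1
  one-mod-P = subst (RepresentableMod s P) gcd≡1 (representableMod-gcdAll s P)
  j : ℕ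
  j = proj₁ one-mod-P
  representable-K : Representable s (1 + (j + N) * P)
  representable-K =
    subst (Representable s) (trans (+-assoc 1 (j * P) (N * P)) (cong (1 +_) (sym (*-distribʳ-+ P j N))))
      (representable-+ s (proj₂ one-mod-P) (representable-* s N (representable-product x s′)))
  N≤K : N ≤ 1 + (j + N) * P
  N≤K = ≤-trans (m≤n+m N j) (≤-trans (m≤m*n (j + N) P) (n≤1+n _))
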